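{- For every even integer $n\geq 14$ there exists a connected, asymmetric, $4$-regular, non-bipartite, and triangle-free graph on $n$ vertices.
   Context: Graphs are finite, simple and undirected. A graph is asymmetric if its only automorphism is the identity. -}

module Defs where

open import Data.Nat using (ℕ; zero; suc)
open import Data.Bool using (Bool; true; false; if_then_else_)
open import Data.Fin using (Fin)
open import Data.List using (List; map; allFin)
open import Data.Nat.ListAction using (sum)
open import Data.Product using (Σ; _×_; ∃-syntax)
open import Relation.Binary.PropositionalEquality using (_≡_; _≢_)
open import Relation.Nullary using (¬_)
open import Function.Bundles using (_↔_; Inverse)

record Graph (n : ℕ) : Set where
  field
    adj     : Fin n → Fin n → Bool
    adj-sym : ∀ i j → adj i j ≡ adj j i
    loopless : ∀ i → adj i i ≡ false
open Graph public

Adj : ∀ {n} → Graph n → Fin n → Fin n → Set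
Adj G i j = adj G i j ≡ true

degree : ∀ {n} → Graph n → Fin n → ℕ
degree {n} G v = sum (map (λ w → if adj G v w then 1 else 0) (allFin n))

Regular : ∀ {n} → ℕ → Graph n → Set
Regular k G = ∀ v → degree G v ≡ k

data Walk {n} (G : Graph n) : Fin n → Fin n → Set where
  here : ∀ {i} → Walk G i i
  step : ∀ {i j k} → Adj G i j → Walk G j k → Walk G i k

Connected : ∀ {n} → Graph n → Set
Connected G = ∀ i j → Walk G i j

IsAutomorphism : ∀ {n} → Graph n → (Fin n ↔ Fin n) → Set
IsAutomorphism G σ = ∀ i j → adj G (Inverse.to σ i) (Inverse.to σ j) ≡ adj G i j

Asymmetric : ∀ {n} → Graph n → Set
Asymmetric {n} G = (σ : Fin n ↔ Fin n) → IsAutomorphism G σ → ∀ i → Inverse.to σ i ≡ i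

Bipartite : ∀ {n} → Graph n → Set
Bipartite {n} G = Σ (Fin n → Bool) λ c → ∀ i j → Adj G i j → c i ≢ c j

TriangleFree : ∀ {n} → Graph n → Set
TriangleFree G = ∀ i j k → ¬ (Adj G i j × Adj G j k × Adj G i k)

-- The graph on 0, …, n − 1 is a fixed gadget on 0–6 followed by a tail in which every v ≥ 7 is
-- joined to v − 6, v − 2, v + 2 and v + 6, an index m ≥ n being reflected to 2n − 1 − m.
-- Every tail edge vw has v − w ≡ 2 or v + w ≡ 2n + 1 (mod 4), and no three residues are pairwise
-- related in this way, so triangles can only occur near the gadget, where there are none.
-- The neighbour v − 2 gives connectivity and 0 1 2 8 6 is a 5-cycle.
-- For asymmetry call y a k-partner of x if x ≠ y share at least k neighbours. Vertex 6 is the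
-- only one without 3-partners (every v ≥ 11 has v − 4), so automorphisms fix it. The vertices
-- 0–12 are then fixed one at a time, each being the only vertex within distance two of a fixed
-- one with its numbers of 3- and 2-partners and of common neighbours with the fixed vertices.
-- Finally v + 6 is the only neighbour of v that is not fixed by induction.

module Submission where

open import Defs
open import Data.Bool using (Bool; true; false; not; if_then_else_; _xor_; T)
open import Data.Bool.Properties using (not-¬; ¬-not; not-distribˡ-xor; not-distribʳ-xor; T-≡)
open import Data.Empty using (⊥; ⊥-elim)
open import Data.Fin using (Fin; toℕ; fromℕ<)
import Data.Fin.Properties as Fin
open import Data.Fin.Properties using (toℕ-injective; toℕ<n; toℕ-fromℕ<; fromℕ<-toℕ)
open import Data.List using (List; []; _∷_; _++_; length; map; filter; allFin; upTo; concatMap; deduplicate)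
open import Data.List.Membership.Propositional using (_∈_; _∉_; find; lose)
open import Data.List.Membership.Propositional.Properties
  using (∈-map⁺; ∈-map⁻; ∈-filter⁺; ∈-filter⁻; ∈-++⁺ˡ; ∈-++⁺ʳ; ∈-++⁻; ∈-concatMap⁺; ∈-concatMap⁻;
         ∈-deduplicate⁺; ∈-deduplicate⁻; ∈-allFin; ∈-upTo⁺; ∈-length)
open import Data.List.Membership.Propositional.Properties.WithK using (unique∧set⇒bag)
open import Data.List.Properties using (length-map; map-cong-local; ≡-dec; filter-accept)
open import Data.List.Relation.Binary.BagAndSetEquality using (∼bag⇒↭)
open import Data.List.Relation.Binary.Permutation.Propositional.Properties using (↭-length)
open import Data.List.Relation.Unary.All using (All; []; _∷_)
import Data.List.Relation.Unary.All as All
open import Data.List.Relation.Unary.All.Properties using (All¬⇒¬Any)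
open import Data.List.Relation.Unary.AllPairs using ([]; _∷_)
open import Data.List.Relation.Unary.Any using (Any; here; there)
import Data.List.Relation.Unary.Any as Any
open import Data.List.Relation.Unary.Unique.Propositional using (Unique)
import Data.List.Relation.Unary.Unique.Propositional.Properties as Unique
open import Data.Nat using (ℕ; zero; suc; _+_; _*_; _∸_; _≤_; _<_; z≤n; s≤s; _<ᵇ_)
open import Data.Nat.Divisibility using (_∣_)
open import Data.Nat.DivMod using (_%_; m*n%n≡0; [m+kn]%n≡m%n; [m+n]%n≡m%n; %-distribˡ-+; m%n%n≡m%n; m%n<n)
open import Data.Nat.Induction using (<-rec)
open import Data.Nat.ListAction using (sum)
open import Data.Nat.Properties
  using (_≟_; _<?_; _≤?_; ≤-refl; ≤-trans; ≤-<-trans; <-≤-trans; <-trans; <-irrefl; <⇒≤; <⇒≱; ≮⇒≥;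
         n≤1+n; m≤m+n; m≤n+m; 0≢1+n; <ᵇ⇒<; <⇒<ᵇ; m∸n+n≡m; m≤n⇒∃[o]m+o≡n; +-suc; +-comm; +-assoc;
         +-cancelˡ-≡; +-cancelʳ-≡; +-cancelʳ-≤; +-monoˡ-≤; +-monoʳ-≤; +-mono-≤; +-mono-≤-<; module ≤-Reasoning)
open import Data.Nat.Solver using (module +-*-Solver)
open +-*-Solver using (solve; _:+_; _:*_; con; _:=_)
open import Data.List.Membership.DecPropositional _≟_ using (_∈?_)
open import Data.List.Relation.Unary.Unique.DecPropositional _≟_ using (unique?)
open import Data.List.Relation.Unary.Unique.DecPropositional.Properties _≟_ using (deduplicate-!)
open import Data.Product using (Σ; ∃-syntax; _×_; _,_; proj₁; proj₂)
open import Data.Sum using (_⊎_; inj₁; inj₂)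
open import Data.Unit using (⊤; tt)
open import Function using (_∘_; _⇔_; mk⇔; Inverse; _↔_; Equivalence)
open import Relation.Binary.PropositionalEquality
  using (_≡_; _≢_; refl; sym; trans; cong; cong₂; subst; subst₂; module ≡-Reasoning)
open import Relation.Nullary using (¬_; Dec; yes; no; does; ¬?)
open import Relation.Nullary.Decidable
  using (True; toWitness; from-yes; dec-true; dec-false; does-⇔; map′; _×-dec_; _⊎-dec_)
open import Relation.Unary using (Decidable)

unique-length-≡ : ∀ {a} {A : Set a} {xs ys : List A} → Unique xs → Unique ys →
                  (∀ {z} → z ∈ xs ⇔ z ∈ ys) → length xs ≡ length ys
unique-length-≡ xs! ys! xs⇔ys = ↭-length (∼bag⇒↭ (unique∧set⇒bag xs! ys! xs⇔ys))

length-≡-by-bijection : ∀ {a} {A : Set a} {f g : A → A} → (∀ x → g (f x) ≡ x) → (∀ x → f (g x) ≡ x) →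
  ∀ {xs ys} → Unique xs → Unique ys → (∀ {z} → z ∈ xs → f z ∈ ys) → (∀ {z} → z ∈ ys → g z ∈ xs) →
  length xs ≡ length ys
length-≡-by-bijection {f = f} {g} g∘f f∘g {xs} {ys} xs! ys! f-maps g-maps = begin
  length xs          ≡⟨ sym (length-map f xs) ⟩
  length (map f xs)  ≡⟨ unique-length-≡ (Unique.map⁺ f-injective xs!) ys! (mk⇔ to from) ⟩
  length ys          ∎
  where
  open ≡-Reasoning
  f-injective : ∀ {x y} → f x ≡ f y → x ≡ y
  f-injective {x} {y} eq = trans (sym (g∘f x)) (trans (cong g eq) (g∘f y))
  to : ∀ {z} → z ∈ map f xs → z ∈ ys
  to z∈ with x , x∈ , refl ← ∈-map⁻ f z∈ = f-maps x∈
  from : ∀ {z} → z ∈ ys → z ∈ map f xs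
  from {z} z∈ = subst (_∈ map f xs) (f∘g z) (∈-map⁺ f (g-maps z∈))

length-≤-filter-++ : ∀ {a p} {A : Set a} {P : A → Set p} (P? : Decidable P) {ys zs} →
                     All P ys → length ys ≤ length (filter P? (ys ++ zs))
length-≤-filter-++ P? []                      = z≤n
length-≤-filter-++ P? {y ∷ ys} {zs} (py ∷ pys) =
  subst (λ xs → suc (length ys) ≤ length xs) (sym (filter-accept P? py)) (s≤s (length-≤-filter-++ P? pys))

sum-indicator≡length-filter : ∀ {a p} {A : Set a} {P : A → Set p} (P? : Decidable P) xs →
  sum (map (λ x → if does (P? x) then 1 else 0) xs) ≡ length (filter P? xs)
sum-indicator≡length-filter P? [] = refl
sum-indicator≡length-filter P? (x ∷ xs) with does (P? x)
... | true  = cong suc (sum-indicator≡length-filter P? xs)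
... | false = sum-indicator≡length-filter P? xs

<-or-+ : ∀ c k → k < c ⊎ ∃[ j ] k ≡ c + j
<-or-+ c k with k <? c
... | yes k<c = inj₁ k<c
... | no  k≮c = inj₂ (proj₁ c+j≡k , sym (proj₂ c+j≡k))
  where c+j≡k = m≤n⇒∃[o]m+o≡n (≮⇒≥ k≮c)

≢-+ʳ : ∀ {a b} → a ≢ b → ∀ k → a + k ≢ b + k
≢-+ʳ a≢b k eq = a≢b (+-cancelʳ-≡ k _ _ eq)

odd≢double : ∀ a b k {m} → (a + b) % 2 ≡ 1 → (a + k) + (b + k) ≢ m + m
odd≢double a b k {m} odd eq = 0≢1+n (begin
  0                          ≡⟨ sym (m*n%n≡0 m 2) ⟩
  (m * 2) % 2                ≡⟨ cong (_% 2) (solve 1 (λ m → m :* con 2 := m :+ m) refl m) ⟩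
  (m + m) % 2                ≡⟨ cong (_% 2) (sym eq) ⟩
  ((a + k) + (b + k)) % 2    ≡⟨ cong (_% 2) (solve 3 (λ a b k → (a :+ k) :+ (b :+ k) := (a :+ b) :+ k :* con 2)
                                                  refl a b k) ⟩
  ((a + b) + k * 2) % 2      ≡⟨ [m+kn]%n≡m%n (a + b) k 2 ⟩
  (a + b) % 2                ≡⟨ odd ⟩
  1                          ∎)
  where open ≡-Reasoning

Mod4Edge : ℕ → ℕ → ℕ → Set
Mod4Edge n v w = (2 + w) % 4 ≡ v % 4 ⊎ (3 + v + w) % 4 ≡ (n + n) % 4

mod4Edge? : ∀ n v w → Dec (Mod4Edge n v w)
mod4Edge? n v w = (2 + w) % 4 ≟ v % 4 ⊎-dec (3 + v + w) % 4 ≟ (n + n) % 4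

%4-+ʳ : ∀ a b → (a + b % 4) % 4 ≡ (a + b) % 4
%4-+ʳ a b = begin
  (a + b % 4) % 4            ≡⟨ %-distribˡ-+ a (b % 4) 4 ⟩
  (a % 4 + b % 4 % 4) % 4    ≡⟨ cong (λ x → (a % 4 + x) % 4) (m%n%n≡m%n b 4) ⟩
  (a % 4 + b % 4) % 4        ≡⟨ sym (%-distribˡ-+ a b 4) ⟩
  (a + b) % 4                ∎
  where open ≡-Reasoning

%4-4+ : ∀ x → (4 + x) % 4 ≡ x % 4
%4-4+ x = trans (cong (_% 4) (+-comm 4 x)) ([m+n]%n≡m%n x 4)

mod4Edge-residues : ∀ {n v w} → Mod4Edge n v w → Mod4Edge (n % 4) (v % 4) (w % 4)
mod4Edge-residues {n} {v} {w} (inj₁ e) = inj₁ (trans (%4-+ʳ 2 w) (trans e (sym (m%n%n≡m%n v 4))))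
mod4Edge-residues {n} {v} {w} (inj₂ e) = inj₂ (begin
  (3 + (v % 4 + w % 4)) % 4      ≡⟨ sym (%4-+ʳ 3 (v % 4 + w % 4)) ⟩
  (3 + (v % 4 + w % 4) % 4) % 4  ≡⟨ cong (λ x → (3 + x) % 4) (sym (%-distribˡ-+ v w 4)) ⟩
  (3 + (v + w) % 4) % 4          ≡⟨ %4-+ʳ 3 (v + w) ⟩
  (3 + v + w) % 4                ≡⟨ e ⟩
  (n + n) % 4                    ≡⟨ %-distribˡ-+ n n 4 ⟩
  (n % 4 + n % 4) % 4            ∎)
  where open ≡-Reasoning

no-residue-triangle : All (λ r → All (λ a → All (λ b → All (λ c →
  ¬ (Mod4Edge r a b × Mod4Edge r a c × Mod4Edge r b c)) (upTo 4)) (upTo 4)) (upTo 4)) (upTo 4)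
no-residue-triangle = from-yes (All.all? (λ r → All.all? (λ a → All.all? (λ b → All.all? (λ c →
  ¬? (mod4Edge? r a b ×-dec mod4Edge? r a c ×-dec mod4Edge? r b c)) (upTo 4)) (upTo 4)) (upTo 4)) (upTo 4))

no-mod4-triangle : ∀ {n a b c} → Mod4Edge n a b → Mod4Edge n a c → Mod4Edge n b c → ⊥
no-mod4-triangle {n} {a} {b} {c} ab ac bc =
  All.lookup (All.lookup (All.lookup (All.lookup no-residue-triangle (residue n)) (residue a)) (residue b))
    (residue c)
    (mod4Edge-residues {n} {a} {b} ab , mod4Edge-residues {n} {a} {c} ac , mod4Edge-residues {n} {b} {c} bc)
  where
  residue : ∀ x → x % 4 ∈ upTo 4
  residue x = ∈-upTo⁺ (m%n<n x 4)

-- Walks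

module _ {n : ℕ} {G : Graph n} where

  _++ʷ_ : ∀ {i j k} → Walk G i j → Walk G j k → Walk G i k
  here       ++ʷ w′ = w′
  step ij w  ++ʷ w′ = step ij (w ++ʷ w′)

  reverseʷ : ∀ {i j} → Walk G i j → Walk G j i
  reverseʷ here                = here
  reverseʷ (step {i} {j} ij w) = reverseʷ w ++ʷ step (trans (adj-sym G j i) ij) here

  odd : ∀ {i j} → Walk G i j → Bool
  odd here       = false
  odd (step _ w) = not (odd w)

  colour-along-walk : (c : Fin n → Bool) → (∀ i j → Adj G i j → c i ≢ c j) →
                      ∀ {i j} (w : Walk G i j) → c j ≡ odd w xor c i
  colour-along-walk c proper here = refl
  colour-along-walk c proper (step {i} {j} {k} ij w) = begin
    c k                     ≡⟨ colour-along-walk c proper w ⟩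
    odd w xor c j           ≡⟨ cong (odd w xor_) (¬-not (proper i j ij ∘ sym)) ⟩
    odd w xor not (c i)     ≡⟨ sym (not-distribʳ-xor (odd w) (c i)) ⟩
    not (odd w xor c i)     ≡⟨ not-distribˡ-xor (odd w) (c i) ⟩
    not (odd w) xor c i     ∎
    where open ≡-Reasoning

  odd-closed-walk⇒¬bipartite : ∀ {i} (w : Walk G i i) → odd w ≡ true → ¬ Bipartite G
  odd-closed-walk⇒¬bipartite w w-odd (c , proper) =
    not-¬ refl (trans (colour-along-walk c proper w) (cong (_xor _) w-odd))

-- Graphs given by adjacency lists

record AdjacencyList (n : ℕ) : Set where
  field
    nbrs        : ℕ → List ℕ
    nbrs-sym    : ∀ {u v} → v ∈ nbrs u → u ∈ nbrs v
    nbrs-irrefl : ∀ v → v ∉ nbrs v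
    nbrs-<      : ∀ {u v} → v ∈ nbrs u → v < n
    nbrs-unique : ∀ v → Unique (nbrs v)

module FromAdjacencyList {n : ℕ} (L : AdjacencyList n) where
  open AdjacencyList L public

  graph : Graph n
  graph = record
    { adj      = λ i j → does (toℕ j ∈? nbrs (toℕ i))
    ; adj-sym  = λ i j → does-⇔ (mk⇔ nbrs-sym nbrs-sym) (toℕ j ∈? nbrs (toℕ i)) (toℕ i ∈? nbrs (toℕ j))
    ; loopless = λ i → dec-false (toℕ i ∈? nbrs (toℕ i)) (nbrs-irrefl (toℕ i))
    }

  Adj⇒∈ : ∀ {i j} → Adj graph i j → toℕ j ∈ nbrs (toℕ i)
  Adj⇒∈ {i} {j} adj with toℕ j ∈? nbrs (toℕ i)
  Adj⇒∈ adj | yes j∈ = j∈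
  Adj⇒∈ () | no _

  ∈⇒Adj : ∀ {u v} (u<n : u < n) (v<n : v < n) → v ∈ nbrs u → Adj graph (fromℕ< u<n) (fromℕ< v<n)
  ∈⇒Adj {u} {v} u<n v<n v∈ = dec-true (toℕ (fromℕ< v<n) ∈? nbrs (toℕ (fromℕ< u<n)))
    (subst₂ (λ a b → b ∈ nbrs a) (sym (toℕ-fromℕ< u<n)) (sym (toℕ-fromℕ< v<n)) v∈)

  degree≡length : ∀ v → degree graph v ≡ length (nbrs (toℕ v))
  degree≡length v = begin
    degree graph v                        ≡⟨ sum-indicator≡length-filter P? (allFin n) ⟩
    length (filter P? (allFin n))         ≡⟨ sym (length-map toℕ (filter P? (allFin n))) ⟩
    length (map toℕ (filter P? (allFin n))) ≡⟨ unique-length-≡ unique (nbrs-unique (toℕ v)) (mk⇔ to from) ⟩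
    length (nbrs (toℕ v))                 ∎
    where
    open ≡-Reasoning
    P? = λ (w : Fin n) → toℕ w ∈? nbrs (toℕ v)
    unique : Unique (map toℕ (filter P? (allFin n)))
    unique = Unique.map⁺ toℕ-injective (Unique.filter⁺ P? (Unique.allFin⁺ n))
    to : ∀ {z} → z ∈ map toℕ (filter P? (allFin n)) → z ∈ nbrs (toℕ v)
    to z∈ with w , w∈ , refl ← ∈-map⁻ toℕ z∈ = proj₂ (∈-filter⁻ P? {xs = allFin n} w∈)
    from : ∀ {z} → z ∈ nbrs (toℕ v) → z ∈ map toℕ (filter P? (allFin n))
    from {z} z∈ = subst (_∈ map toℕ (filter P? (allFin n))) (toℕ-fromℕ< z<n)
      (∈-map⁺ toℕ (∈-filter⁺ P? (∈-allFin (fromℕ< z<n))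
        (subst (_∈ nbrs (toℕ v)) (sym (toℕ-fromℕ< z<n)) z∈)))
      where z<n = nbrs-< z∈

  regular : ∀ {k} → (∀ {v} → v < n → length (nbrs v) ≡ k) → Regular k graph
  regular length≡k v = trans (degree≡length v) (length≡k (toℕ<n v))

  connected : (∀ {v} → 0 < v → v < n → ∃[ u ] u < v × u ∈ nbrs v) → Connected graph
  connected descend i j = to-root i ++ʷ reverseʷ (to-root j)
    where
    0<n : 0 < n
    0<n = ≤-<-trans z≤n (toℕ<n i)
    ReachesRoot : ℕ → Set
    ReachesRoot v = (v<n : v < n) → Walk graph (fromℕ< v<n) (fromℕ< 0<n)
    reaches-root : ∀ v → ReachesRoot v
    reaches-root = <-rec ReachesRoot go
      where
      go : ∀ v → (∀ {u} → u < v → ReachesRoot u) → ReachesRoot v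
      go zero    _   _   = here
      go (suc v) rec v<n with u , u<v , u∈ ← descend (s≤s z≤n) v<n =
        step (∈⇒Adj v<n (<-trans u<v v<n) u∈) (rec u<v (<-trans u<v v<n))
    to-root : ∀ k → Walk graph k (fromℕ< 0<n)
    to-root k = subst (λ x → Walk graph x (fromℕ< 0<n)) (fromℕ<-toℕ k (toℕ<n k))
      (reaches-root (toℕ k) (toℕ<n k))

  triangleFree : (∀ {u v w} → v ∈ nbrs u → w ∈ nbrs u → w ∉ nbrs v) → TriangleFree graph
  triangleFree no-triangle i j k (ij , jk , ik) = no-triangle (Adj⇒∈ ij) (Adj⇒∈ ik) (Adj⇒∈ jk)

  record Automorphism : Set where
    field
      to from   : ℕ → ℕ
      from∘to   : ∀ x → from (to x) ≡ x
      to∘from   : ∀ x → to (from x) ≡ x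
      to-nbrs   : ∀ {x y} → y ∈ nbrs x → to y ∈ nbrs (to x)
      from-nbrs : ∀ {x y} → y ∈ nbrs x → from y ∈ nbrs (from x)

  inverse : Automorphism → Automorphism
  inverse A = record
    { to = from ; from = to ; from∘to = to∘from ; to∘from = from∘to
    ; to-nbrs = from-nbrs ; from-nbrs = to-nbrs }
    where open Automorphism A

  extend : (Fin n → Fin n) → ℕ → ℕ
  extend f x with x <? n
  ... | yes x<n = toℕ (f (fromℕ< x<n))
  ... | no  _   = x

  extend-toℕ : ∀ f i → extend f (toℕ i) ≡ toℕ (f i)
  extend-toℕ f i with toℕ i <? n
  ... | yes i<n = cong (toℕ ∘ f) (fromℕ<-toℕ i i<n)
  ... | no  i≮n = ⊥-elim (i≮n (toℕ<n i))

  extend-≮ : ∀ f {x} → ¬ x < n → extend f x ≡ x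
  extend-≮ f {x} x≮n with x <? n
  ... | yes x<n = ⊥-elim (x≮n x<n)
  ... | no  _   = refl

  extend-inverse : ∀ {f g} → (∀ i → g (f i) ≡ i) → ∀ x → extend g (extend f x) ≡ x
  extend-inverse {f} {g} g∘f x with x <? n
  ... | no  x≮n = extend-≮ g x≮n
  ... | yes x<n = begin
    extend g (toℕ (f i))         ≡⟨ extend-toℕ g (f i) ⟩
    toℕ (g (f i))                ≡⟨ cong toℕ (g∘f i) ⟩
    toℕ i                        ≡⟨ x≡i ⟩
    x                            ∎
    where
    open ≡-Reasoning
    i = fromℕ< x<n
    x≡i = toℕ-fromℕ< x<n

  extend-nbrs : ∀ {f} → (∀ i j → adj graph (f i) (f j) ≡ adj graph i j) →
                ∀ {x y} → y ∈ nbrs x → extend f y ∈ nbrs (extend f x)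
  extend-nbrs {f} f-adj {x} {y} y∈ = subst₂ (λ a b → b ∈ nbrs a) (ext x<n) (ext y<n)
    (Adj⇒∈ (trans (f-adj (fromℕ< x<n) (fromℕ< y<n)) (∈⇒Adj x<n y<n y∈)))
    where
    x<n = nbrs-< (nbrs-sym y∈)
    y<n = nbrs-< y∈
    ext : ∀ {z} (z<n : z < n) → toℕ (f (fromℕ< z<n)) ≡ extend f z
    ext z<n = trans (sym (extend-toℕ f (fromℕ< z<n))) (cong (extend f) (toℕ-fromℕ< z<n))

  extendAutomorphism : (σ : Fin n ↔ Fin n) → IsAutomorphism graph σ → Automorphism
  extendAutomorphism σ σ-adj = record
    { to        = extend to
    ; from      = extend from
    ; from∘to   = extend-inverse strictlyInverseʳ
    ; to∘from   = extend-inverse strictlyInverseˡ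
    ; to-nbrs   = extend-nbrs σ-adj
    ; from-nbrs = extend-nbrs from-adj
    }
    where
    open Inverse σ
    from-adj : ∀ i j → adj graph (from i) (from j) ≡ adj graph i j
    from-adj i j =
      trans (sym (σ-adj (from i) (from j))) (cong₂ (adj graph) (strictlyInverseˡ i) (strictlyInverseˡ j))

  asymmetric : (∀ (A : Automorphism) {x} → x < n → Automorphism.to A x ≡ x) → Asymmetric graph
  asymmetric fixes σ σ-adj i =
    toℕ-injective (trans (sym (extend-toℕ (Inverse.to σ) i)) (fixes (extendAutomorphism σ σ-adj) (toℕ<n i)))

-- Invariants of automorphisms

module Profiles (nbrs : ℕ → List ℕ) where

  common : ℕ → ℕ → List ℕ
  common x y = filter (_∈? nbrs y) (nbrs x)

  #common : ℕ → ℕ → ℕ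
  #common x y = length (common x y)

  nbrs² : ℕ → List ℕ
  nbrs² x = deduplicate _≟_ (concatMap nbrs (nbrs x))

  ball : ℕ → List ℕ
  ball x = nbrs x ++ nbrs² x

  partners : ℕ → ℕ → List ℕ
  partners k x = filter (λ y → ¬? (y ≟ x) ×-dec k ≤? #common x y) (nbrs² x)

  profile : List ℕ → ℕ → List ℕ
  profile F x = length (partners 3 x) ∷ length (partners 2 x) ∷ map (#common x) F

  Distinguished : List ℕ → ℕ → ℕ → Set
  Distinguished F u w = u ∈ F × w ∈ ball u × All (λ z → z ≡ w ⊎ z ∈ F ⊎ profile F z ≢ profile F w) (ball u)

  distinguished? : ∀ F u w → Dec (Distinguished F u w)
  distinguished? F u w = u ∈? F ×-dec w ∈? ball u ×-dec
    All.all? (λ z → z ≟ w ⊎-dec z ∈? F ⊎-dec ¬? (≡-dec _≟_ (profile F z) (profile F w))) (ball u)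

  Certificate : List ℕ → List (ℕ × ℕ) → Set
  Certificate F []              = ⊤
  Certificate F ((u , w) ∷ uws) = Distinguished F u w × Certificate (w ∷ F) uws

  certificate? : ∀ F uws → Dec (Certificate F uws)
  certificate? F []              = yes tt
  certificate? F ((u , w) ∷ uws) = distinguished? F u w ×-dec certificate? (w ∷ F) uws

module Refinement {n : ℕ} (L : AdjacencyList n) where
  open FromAdjacencyList L
  open Profiles nbrs

  Fixes : Automorphism → List ℕ → Set
  Fixes A F = ∀ {z} → z ∈ F → Automorphism.to A z ≡ z

  module _ (A : Automorphism) where
    open Automorphism A

    to-injective : ∀ {x y} → to x ≡ to y → x ≡ y
    to-injective {x} {y} eq = trans (sym (from∘to x)) (trans (cong from eq) (from∘to y))

    to-< : ∀ {u v} → u ∈ nbrs v → to v < n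
    to-< u∈ = nbrs-< (to-nbrs (nbrs-sym u∈))

    common-preserved : ∀ {x y z} → z ∈ common x y → to z ∈ common (to x) (to y)
    common-preserved {x} {y} z∈ with z∈x , z∈y ← ∈-filter⁻ (_∈? nbrs y) {xs = nbrs x} z∈ =
      ∈-filter⁺ (_∈? nbrs (to y)) (to-nbrs z∈x) (to-nbrs z∈y)

    nbrs²-preserved : ∀ {x z} → z ∈ nbrs² x → to z ∈ nbrs² (to x)
    nbrs²-preserved {x} z∈
      with a , a∈ , z∈a ← find (∈-concatMap⁻ nbrs {xs = nbrs x} (∈-deduplicate⁻ _≟_ _ z∈)) =
      ∈-deduplicate⁺ _≟_ (∈-concatMap⁺ nbrs (lose (to-nbrs a∈) (to-nbrs z∈a)))

    ball-preserved : ∀ {x z} → z ∈ ball x → to z ∈ ball (to x)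
    ball-preserved {x} z∈ with ∈-++⁻ (nbrs x) z∈
    ... | inj₁ z∈₁ = ∈-++⁺ˡ (to-nbrs z∈₁)
    ... | inj₂ z∈₂ = ∈-++⁺ʳ (nbrs (to x)) (nbrs²-preserved z∈₂)

  module _ (A : Automorphism) where
    open Automorphism A

    #common-invariant : ∀ x y → #common (to x) (to y) ≡ #common x y
    #common-invariant x y = sym (length-≡-by-bijection from∘to to∘from
      (Unique.filter⁺ (_∈? nbrs y) (nbrs-unique x)) (Unique.filter⁺ (_∈? nbrs (to y)) (nbrs-unique (to x)))
      (common-preserved A)
      (λ {z} z∈ → subst₂ (λ a b → from z ∈ common a b) (from∘to x) (from∘to y)
                    (common-preserved (inverse A) z∈)))

    partners-preserved : ∀ k {x y} → y ∈ partners k x → to y ∈ partners k (to x)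
    partners-preserved k {x} {y} y∈
      with y∈² , y≢x , k≤ ← ∈-filter⁻ (λ y → ¬? (y ≟ x) ×-dec k ≤? #common x y) {xs = nbrs² x} y∈ =
      ∈-filter⁺ (λ y → ¬? (y ≟ to x) ×-dec k ≤? #common (to x) y) (nbrs²-preserved A y∈²)
        (y≢x ∘ to-injective A , subst (k ≤_) (sym (#common-invariant x y)) k≤)

  module _ (A : Automorphism) where
    open Automorphism A

    partners-invariant : ∀ k x → length (partners k (to x)) ≡ length (partners k x)
    partners-invariant k x = sym (length-≡-by-bijection from∘to to∘from
      (Unique.filter⁺ _ (deduplicate-! (concatMap nbrs (nbrs x))))
      (Unique.filter⁺ _ (deduplicate-! (concatMap nbrs (nbrs (to x)))))
      (partners-preserved A k)
      (λ {z} z∈ → subst (λ a → from z ∈ partners k a) (from∘to x) (partners-preserved (inverse A) k z∈)))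

    profile-invariant : ∀ {F} → Fixes A F → ∀ x → profile F (to x) ≡ profile F x
    profile-invariant {F} fixes x = cong₂ _∷_ (partners-invariant 3 x) (cong₂ _∷_ (partners-invariant 2 x)
      (map-cong-local (All.tabulate (λ {z} z∈ →
        trans (cong (#common (to x)) (sym (fixes z∈))) (#common-invariant A x z)))))

  module _ (A : Automorphism) where
    open Automorphism A

    fixes-distinguished : ∀ {F u w} → Fixes A F → Distinguished F u w → to w ≡ w
    fixes-distinguished {F} {u} {w} fixes (u∈F , w∈ball , separated)
      with All.lookup separated (subst (λ a → to w ∈ ball a) (fixes u∈F) (ball-preserved A w∈ball))
    ... | inj₁ to-w≡w                 = to-w≡w
    ... | inj₂ (inj₁ to-w∈F)          = to-injective A (fixes to-w∈F)
    ... | inj₂ (inj₂ profile≢)        = ⊥-elim (profile≢ (profile-invariant A fixes w))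

    fixes-certified : ∀ {F uws} → Fixes A F → Certificate F uws → Fixes A (map proj₂ uws)
    fixes-certified {F} {(u , w) ∷ uws} fixes (distinguished , certificate) (here refl) =
      fixes-distinguished fixes distinguished
    fixes-certified {F} {(u , w) ∷ uws} fixes (distinguished , certificate) (there z∈) =
      fixes-certified {w ∷ F} fixes′ certificate z∈
      where
      fixes′ : Fixes A (w ∷ F)
      fixes′ (here refl) = fixes-distinguished fixes distinguished
      fixes′ (there z∈F) = fixes z∈F

    fixes-only-partnerless : ∀ k {u v} → u ∈ nbrs v → length (partners k v) ≡ 0 →
                          (∀ {x} → x < n → x ≢ v → 0 < length (partners k x)) → to v ≡ v
    fixes-only-partnerless k {u} {v} u∈ partnerless others with to v ≟ v
    ... | yes to-v≡v = to-v≡v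
    ... | no  to-v≢v =
      ⊥-elim (<-irrefl (sym (trans (partners-invariant A k v) partnerless)) (others (to-< A u∈) to-v≢v))

    fixes-last-neighbour : ∀ {v x} → x ∈ nbrs v → to v ≡ v →
                           (∀ {z} → z ∈ nbrs v → z ≢ x → to z ≡ z) → to x ≡ x
    fixes-last-neighbour {v} {x} x∈ to-v≡v others with to x ≟ x
    ... | yes to-x≡x = to-x≡x
    ... | no  to-x≢x = to-injective A (others (subst (λ a → to x ∈ nbrs a) to-v≡v (to-nbrs x∈)) to-x≢x)

-- The construction

fold : ℕ → ℕ → ℕ
fold n m = if m <ᵇ n then m else n + n ∸ suc m

fold-inside : ∀ {n m} → m < n → fold n m ≡ m
fold-inside {n} {m} m<n rewrite Equivalence.to T-≡ (<⇒<ᵇ m<n) = refl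

fold-outside : ∀ {n m} → n ≤ m → m < n + n → fold n m + suc m ≡ n + n
fold-outside {n} {m} n≤m m<2n with m <ᵇ n in eq
... | true  = ⊥-elim (<⇒≱ (<ᵇ⇒< m n (subst T (sym eq) tt)) n≤m)
... | false = m∸n+n≡m m<2n

nbrs₀ : ℕ → ℕ → List ℕ
nbrs₀ n 0 = 1 ∷ 4 ∷ 5 ∷ 6 ∷ []
nbrs₀ n 1 = 0 ∷ 2 ∷ 3 ∷ 7 ∷ []
nbrs₀ n 2 = 1 ∷ 4 ∷ 5 ∷ 8 ∷ []
nbrs₀ n 3 = 1 ∷ 4 ∷ 6 ∷ 9 ∷ []
nbrs₀ n 4 = 0 ∷ 2 ∷ 3 ∷ 10 ∷ []
nbrs₀ n 5 = 0 ∷ 2 ∷ 7 ∷ 11 ∷ []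
nbrs₀ n 6 = 0 ∷ 3 ∷ 8 ∷ 12 ∷ []
nbrs₀ n v = v ∸ 6 ∷ v ∸ 2 ∷ fold n (2 + v) ∷ fold n (6 + v) ∷ []

nbrs : ℕ → ℕ → List ℕ
nbrs n v = if v <ᵇ n then nbrs₀ n v else []

-- Found by computer search.
certificate : ℕ → List (ℕ × ℕ)
certificate 14 = (6 , 0) ∷ (0 , 1) ∷ (1 , 2) ∷ (2 , 3) ∷ (3 , 4) ∷ (4 , 5) ∷ (5 , 7) ∷ (7 , 8) ∷ (7 , 9)
               ∷ (9 , 10) ∷ (10 , 11) ∷ (11 , 12) ∷ []
certificate 15 = (6 , 11) ∷ (11 , 0) ∷ (0 , 1) ∷ (1 , 2) ∷ (2 , 3) ∷ (3 , 4) ∷ (4 , 5) ∷ (5 , 7) ∷ (5 , 8)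
               ∷ (8 , 9) ∷ (8 , 10) ∷ (10 , 12) ∷ []
certificate 16 = (6 , 13) ∷ (13 , 1) ∷ (1 , 0) ∷ (0 , 2) ∷ (2 , 3) ∷ (3 , 4) ∷ (4 , 5) ∷ (5 , 7) ∷ (5 , 8)
               ∷ (7 , 9) ∷ (9 , 10) ∷ (9 , 11) ∷ (11 , 12) ∷ []
certificate n  = (6 , fold n 18) ∷ (6 , 1) ∷ (1 , 0) ∷ (0 , 2) ∷ (0 , 3) ∷ (0 , 4) ∷ (0 , 5) ∷ (0 , 7) ∷ (0 , 8)
               ∷ (1 , 9) ∷ (0 , 10) ∷ (0 , 11) ∷ (0 , 12) ∷ []

module _ (n : ℕ) where
  open Profiles (nbrs n)

  record Checks : Set where
    field
      triangle-free-near-gadget :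
        All (λ u → All (λ v → All (λ w → w ∉ nbrs n v) (nbrs n u)) (nbrs n u)) (upTo 13)
      six-partnerless           : length (partners 3 6) ≡ 0
      partnered-below-11        : All (λ x → x ≡ 6 ⊎ 0 < length (partners 3 x)) (upTo 11)
      certified                 : Certificate (6 ∷ []) (certificate n)
      certificate-covers        : All (_∈ 6 ∷ map proj₂ (certificate n)) (upTo 13)

  checks? : Dec Checks
  checks? = map′ fromProduct toProduct
    (All.all? (λ u → All.all? (λ v → All.all? (λ w → ¬? (w ∈? nbrs n v)) (nbrs n u)) (nbrs n u)) (upTo 13)
      ×-dec length (partners 3 6) ≟ 0
      ×-dec All.all? (λ x → x ≟ 6 ⊎-dec 0 <? length (partners 3 x)) (upTo 11)
      ×-dec certificate? (6 ∷ []) (certificate n)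
      ×-dec All.all? (_∈? 6 ∷ map proj₂ (certificate n)) (upTo 13))
    where
    fromProduct : _ → Checks
    fromProduct (t , l , p , c , v) = record
      { triangle-free-near-gadget = t ; six-partnerless = l ; partnered-below-11 = p
      ; certified = c ; certificate-covers = v }
    toProduct : Checks → _
    toProduct c = let open Checks c in
      triangle-free-near-gadget , six-partnerless , partnered-below-11 , certified , certificate-covers

checks-below-37 : ∀ (i : Fin 23) → Checks (14 + toℕ i)
checks-below-37 = from-yes (Fin.all? {n = 23} (λ i → checks? (14 + toℕ i)))

-- For n ≥ 37 the checks only compare n with numbers below 37, so they also evaluate for symbolic n = 37 + e.
checks-from-37 : ∀ e → Checks (37 + e)
checks-from-37 e = from-yes (checks? (37 + e))

checks : ∀ {n} → 14 ≤ n → Checks n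
checks {n} 14≤n with <-or-+ 14 n
... | inj₁ n<14 = ⊥-elim (<⇒≱ n<14 14≤n)
... | inj₂ (m , refl) with <-or-+ 23 m
...   | inj₁ m<23       = subst (λ k → Checks (14 + k)) (toℕ-fromℕ< m<23) (checks-below-37 (fromℕ< m<23))
...   | inj₂ (e , refl) = checks-from-37 e

module Construction {n : ℕ} (14≤n : 14 ≤ n) where

  reflected-< : ∀ {m w} → n ≤ m → w + suc m ≡ n + n → w < n
  reflected-< {m} {w} n≤m eq = +-cancelʳ-≤ n (suc w) n (begin
    suc w + n    ≡⟨ sym (+-suc w n) ⟩
    w + suc n    ≤⟨ +-monoʳ-≤ w (s≤s n≤m) ⟩
    w + suc m    ≡⟨ eq ⟩
    n + n        ∎)
    where open ≤-Reasoning

  fold-< : ∀ {m} → m < n + n → fold n m < n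
  fold-< {m} m<2n with m <? n
  ... | yes m<n = subst (_< n) (sym (fold-inside m<n)) m<n
  ... | no  m≮n = reflected-< (≮⇒≥ m≮n) (fold-outside (≮⇒≥ m≮n) m<2n)

  reflected-≥ : ∀ {d v w} → d ≤ 6 → v < n → w + suc (d + v) ≡ n + n → 7 ≤ w
  reflected-≥ {d} {v} {w} d≤6 v<n eq = <⇒≤ (+-cancelʳ-≤ 6 8 w (≤-trans 14≤n n≤w+6))
    where
    n≤w+6 : n ≤ w + 6
    n≤w+6 = +-cancelʳ-≤ n n (w + 6) (begin
      n + n            ≡⟨ sym eq ⟩
      w + suc (d + v)  ≡⟨ cong (w +_) (sym (+-suc d v)) ⟩
      w + (d + suc v)  ≤⟨ +-monoʳ-≤ w (+-mono-≤ d≤6 v<n) ⟩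
      w + (6 + n)      ≡⟨ sym (+-assoc w 6 n) ⟩
      w + 6 + n        ∎)
      where open ≤-Reasoning

  2≤6 : 2 ≤ 6
  2≤6 = from-yes (2 ≤? 6)

  shift<n+n : ∀ {d v} → d ≤ 6 → v < n → d + v < n + n
  shift<n+n d≤6 v<n = +-mono-≤-< (≤-trans d≤6 (≤-trans (n≤1+n 6) (≤-trans (m≤m+n 7 7) 14≤n))) v<n

  fold-reflect : ∀ {d v} → d ≤ 6 → v < n → n ≤ d + v →
                 7 ≤ fold n (d + v) × fold n (d + fold n (d + v)) ≡ v
  fold-reflect {d} {v} d≤6 v<n n≤d+v = reflected-≥ d≤6 v<n eq , back
    where
    w = fold n (d + v)
    eq : w + suc (d + v) ≡ n + n
    eq = fold-outside n≤d+v (shift<n+n d≤6 v<n)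
    w<n : w < n
    w<n = reflected-< n≤d+v eq
    n≤d+w : n ≤ d + w
    n≤d+w = +-cancelʳ-≤ n n (d + w) (begin
      n + n            ≡⟨ sym eq ⟩
      w + suc (d + v)  ≡⟨ solve 3 (λ w d v → w :+ (con 1 :+ (d :+ v)) := (d :+ w) :+ (con 1 :+ v))
                                  refl w d v ⟩
      d + w + suc v    ≤⟨ +-monoʳ-≤ (d + w) v<n ⟩
      d + w + n        ∎)
      where open ≤-Reasoning
    back : fold n (d + w) ≡ v
    back = +-cancelˡ-≡ (suc d + w) (fold n (d + w)) v (begin
      suc d + w + fold n (d + w)   ≡⟨ +-comm (suc d + w) (fold n (d + w)) ⟩
      fold n (d + w) + suc (d + w) ≡⟨ fold-outside n≤d+w (shift<n+n d≤6 w<n) ⟩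
      n + n                        ≡⟨ sym eq ⟩
      w + suc (d + v)              ≡⟨ solve 3 (λ w d v → w :+ (con 1 :+ (d :+ v)) := (con 1 :+ d :+ w) :+ v)
                                              refl w d v ⟩
      suc d + w + v                ∎)
      where open ≡-Reasoning

  nbrs≡nbrs₀ : ∀ {v} → v < n → nbrs n v ≡ nbrs₀ n v
  nbrs≡nbrs₀ v<n rewrite Equivalence.to T-≡ (<⇒<ᵇ v<n) = refl

  nbrs≡[] : ∀ {v} → ¬ v < n → nbrs n v ≡ []
  nbrs≡[] {v} v≮n with v <ᵇ n in eq
  ... | true  = ⊥-elim (v≮n (<ᵇ⇒< v n (subst T (sym eq) tt)))
  ... | false = refl

  ∈-nbrs⁺ : ∀ {u v} → u < n → v ∈ nbrs₀ n u → v ∈ nbrs n u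
  ∈-nbrs⁺ u<n = subst (_ ∈_) (sym (nbrs≡nbrs₀ u<n))

  ∈-nbrs⁻ : ∀ {u v} → v ∈ nbrs n u → u < n × v ∈ nbrs₀ n u
  ∈-nbrs⁻ {u} v∈ with u <ᵇ n in eq
  ... | true = <ᵇ⇒< u n (subst T (sym eq) tt) , v∈

  nbrs₀-tail : ∀ {v} → 7 ≤ v → nbrs₀ n v ≡ v ∸ 6 ∷ v ∸ 2 ∷ fold n (2 + v) ∷ fold n (6 + v) ∷ []
  nbrs₀-tail (s≤s (s≤s (s≤s (s≤s (s≤s (s≤s (s≤s _))))))) = refl

  nbrs₀-length : ∀ v → length (nbrs₀ n v) ≡ 4
  nbrs₀-length 0 = refl
  nbrs₀-length 1 = refl
  nbrs₀-length 2 = refl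
  nbrs₀-length 3 = refl
  nbrs₀-length 4 = refl
  nbrs₀-length 5 = refl
  nbrs₀-length 6 = refl
  nbrs₀-length (suc (suc (suc (suc (suc (suc (suc _))))))) = refl

  -- These checks hold for every n: they only inspect the gadget and the first two entries of tail lists.
  gadget-bounded : All (λ u → All (_< 13) (nbrs₀ n u)) (upTo 7)
  gadget-bounded = from-yes (All.all? (λ u → All.all? (_<? 13) (nbrs₀ n u)) (upTo 7))

  gadget-sym : All (λ u → All (λ v → u ∈ nbrs₀ n v) (nbrs₀ n u)) (upTo 7)
  gadget-sym = from-yes (All.all? (λ u → All.all? (λ v → u ∈? nbrs₀ n v) (nbrs₀ n u)) (upTo 7))

  gadget-up6 : All (λ k → 7 + k ∈ nbrs₀ n (1 + k)) (upTo 6)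
  gadget-up6 = from-yes (All.all? (λ k → 7 + k ∈? nbrs₀ n (1 + k)) (upTo 6))

  gadget-up2 : All (λ k → 7 + k ∈ nbrs₀ n (5 + k)) (upTo 2)
  gadget-up2 = from-yes (All.all? (λ k → 7 + k ∈? nbrs₀ n (5 + k)) (upTo 2))

  gadget-irrefl : All (λ v → v ∉ nbrs₀ n v) (upTo 7)
  gadget-irrefl = from-yes (All.all? (λ v → ¬? (v ∈? nbrs₀ n v)) (upTo 7))

  gadget-unique : All (λ v → Unique (nbrs₀ n v)) (upTo 7)
  gadget-unique = from-yes (All.all? (λ v → unique? (nbrs₀ n v)) (upTo 7))

  gadget-descends : All (λ v → v ≡ 0 ⊎ Any (_< v) (nbrs₀ n v)) (upTo 7)
  gadget-descends = from-yes (All.all? (λ v → v ≟ 0 ⊎-dec Any.any? (_<? v) (nbrs₀ n v)) (upTo 7))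

  tail-bounded : ∀ k {w} → 7 + k < n → w ∈ nbrs₀ n (7 + k) → w < n
  tail-bounded k v<n (here refl)                         = ≤-<-trans (s≤s (m≤n+m k 6)) v<n
  tail-bounded k v<n (there (here refl))                 = ≤-<-trans (s≤s (m≤n+m (4 + k) 2)) v<n
  tail-bounded k v<n (there (there (here refl)))         = fold-< (shift<n+n 2≤6 v<n)
  tail-bounded k v<n (there (there (there (here refl)))) = fold-< (shift<n+n ≤-refl v<n)

  nbrs₀-bounded : ∀ {u v} → u < n → v ∈ nbrs₀ n u → v < n
  nbrs₀-bounded {u} u<n v∈ with <-or-+ 7 u
  ... | inj₁ u<7 =
    <-≤-trans (All.lookup (All.lookup gadget-bounded (∈-upTo⁺ u<7)) v∈) (≤-trans (n≤1+n 13) 14≤n)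
  ... | inj₂ (k , refl) = tail-bounded k u<n v∈

  tail-sym : ∀ k {w} → 7 + k < n → w ∈ nbrs₀ n (7 + k) → 7 + k ∈ nbrs₀ n w
  tail-sym k v<n (here refl) with <-or-+ 6 k
  ... | inj₁ k<6       = All.lookup gadget-up6 (∈-upTo⁺ k<6)
  ... | inj₂ (j , refl) = there (there (there (here (sym (fold-inside v<n)))))
  tail-sym k v<n (there (here refl)) with <-or-+ 2 k
  ... | inj₁ k<2       = All.lookup gadget-up2 (∈-upTo⁺ k<2)
  ... | inj₂ (j , refl) = there (there (here (sym (fold-inside v<n))))
  tail-sym k v<n (there (there (here refl))) with 9 + k <? n
  ... | yes w<n rewrite fold-inside w<n = there (here refl)
  ... | no  w≮n with 7≤w , back ← fold-reflect 2≤6 v<n (≮⇒≥ w≮n) rewrite nbrs₀-tail 7≤w =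
    there (there (here (sym back)))
  tail-sym k v<n (there (there (there (here refl)))) with 13 + k <? n
  ... | yes w<n rewrite fold-inside w<n = here refl
  ... | no  w≮n with 7≤w , back ← fold-reflect ≤-refl v<n (≮⇒≥ w≮n) rewrite nbrs₀-tail 7≤w =
    there (there (there (here (sym back))))

  nbrs₀-sym : ∀ {u v} → u < n → v ∈ nbrs₀ n u → u ∈ nbrs₀ n v
  nbrs₀-sym {u} u<n v∈ with <-or-+ 7 u
  ... | inj₁ u<7       = All.lookup (All.lookup gadget-sym (∈-upTo⁺ u<7)) v∈
  ... | inj₂ (k , refl) = tail-sym k u<n v∈

  ≢-fold : ∀ c e k → e + k < n + n → c ≢ e → (c + suc e) % 2 ≡ 1 → c + k ≢ fold n (e + k)
  ≢-fold c e k m<2n c≢e odd eq with e + k <? n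
  ... | yes m<n = ≢-+ʳ c≢e k (trans eq (fold-inside m<n))
  ... | no  m≮n = odd≢double c (suc e) k {n} odd
    (subst (λ x → x + suc (e + k) ≡ n + n) (sym eq) (fold-outside (≮⇒≥ m≮n) m<2n))

  fold≢fold : ∀ k → 7 + k < n → fold n (9 + k) ≢ fold n (13 + k)
  fold≢fold k v<n eq with 9 + k <? n
  ... | yes m<n = ≢-fold 9 13 k (shift<n+n ≤-refl v<n) (λ ()) refl (trans (sym (fold-inside m<n)) eq)
  ... | no  m≮n = ≢-+ʳ {10} {14} (λ ()) k (+-cancelˡ-≡ (fold n (9 + k)) _ _ (begin
    fold n (9 + k) + (10 + k)   ≡⟨ fold-outside 9+k≥n (shift<n+n 2≤6 v<n) ⟩
    n + n                       ≡⟨ sym (fold-outside (≤-trans 9+k≥n (+-monoˡ-≤ k 9≤13))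
                                                     (shift<n+n ≤-refl v<n)) ⟩
    fold n (13 + k) + (14 + k)  ≡⟨ cong (_+ (14 + k)) (sym eq) ⟩
    fold n (9 + k) + (14 + k)   ∎))
    where
    open ≡-Reasoning
    9+k≥n = ≮⇒≥ m≮n
    9≤13 : 9 ≤ 13
    9≤13 = from-yes (9 ≤? 13)

  tail-irrefl : ∀ k → 7 + k < n → 7 + k ∉ nbrs₀ n (7 + k)
  tail-irrefl k v<n = All¬⇒¬Any
    (≢-+ʳ (λ ()) k ∷ ≢-+ʳ (λ ()) k ∷ ≢-fold 7 9 k (shift<n+n 2≤6 v<n) (λ ()) refl
      ∷ ≢-fold 7 13 k (shift<n+n ≤-refl v<n) (λ ()) refl ∷ [])

  tail-unique : ∀ k → 7 + k < n → Unique (nbrs₀ n (7 + k))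
  tail-unique k v<n =
      (≢-+ʳ (λ ()) k ∷ ≢-fold 1 9 k 9+k<2n (λ ()) refl ∷ ≢-fold 1 13 k 13+k<2n (λ ()) refl ∷ [])
    ∷ (≢-fold 5 9 k 9+k<2n (λ ()) refl ∷ ≢-fold 5 13 k 13+k<2n (λ ()) refl ∷ [])
    ∷ (fold≢fold k v<n ∷ [])
    ∷ []
    ∷ []
    where
    9+k<2n = shift<n+n 2≤6 v<n
    13+k<2n = shift<n+n ≤-refl v<n

  tail-mod4 : ∀ k {w} → 7 + k < n → w ∈ nbrs₀ n (7 + k) → Mod4Edge n (7 + k) w
  tail-mod4 k v<n (here refl)         = inj₁ (sym (%4-4+ (3 + k)))
  tail-mod4 k v<n (there (here refl)) = inj₁ refl
  tail-mod4 k v<n (there (there (here refl))) with 9 + k <? n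
  ... | yes w<n rewrite fold-inside w<n = inj₁ (%4-4+ (7 + k))
  ... | no  w≮n = inj₂ (cong (_% 4) (trans (+-comm (10 + k) (fold n (9 + k)))
                                          (fold-outside (≮⇒≥ w≮n) (shift<n+n 2≤6 v<n))))
  tail-mod4 k v<n (there (there (there (here refl)))) with 13 + k <? n
  ... | yes w<n rewrite fold-inside w<n = inj₁ (trans (%4-4+ (11 + k)) (%4-4+ (7 + k)))
  ... | no  w≮n = inj₂ (trans (sym (%4-4+ (10 + k + fold n (13 + k))))
                             (cong (_% 4) (trans (+-comm (14 + k) (fold n (13 + k)))
                                                 (fold-outside (≮⇒≥ w≮n) (shift<n+n ≤-refl v<n)))))

  tail-nbrs-≥7 : ∀ k {w} → 13 + k < n → w ∈ nbrs₀ n (13 + k) → 7 ≤ w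
  tail-nbrs-≥7 k u<n (here refl)         = m≤m+n 7 k
  tail-nbrs-≥7 k u<n (there (here refl)) = m≤m+n 7 (4 + k)
  tail-nbrs-≥7 k u<n (there (there (here refl))) with 15 + k <? n
  ... | yes w<n rewrite fold-inside w<n = m≤m+n 7 (8 + k)
  ... | no  w≮n = proj₁ (fold-reflect 2≤6 u<n (≮⇒≥ w≮n))
  tail-nbrs-≥7 k u<n (there (there (there (here refl)))) with 19 + k <? n
  ... | yes w<n rewrite fold-inside w<n = m≤m+n 7 (12 + k)
  ... | no  w≮n = proj₁ (fold-reflect ≤-refl u<n (≮⇒≥ w≮n))

  adjacencyList : AdjacencyList n
  adjacencyList = record
    { nbrs        = nbrs n
    ; nbrs-sym    = symmetric
    ; nbrs-irrefl = irrefl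
    ; nbrs-<      = bounded
    ; nbrs-unique = unique
    }
    where
    bounded : ∀ {u v} → v ∈ nbrs n u → v < n
    bounded v∈ with u<n , v∈₀ ← ∈-nbrs⁻ v∈ = nbrs₀-bounded u<n v∈₀
    symmetric : ∀ {u v} → v ∈ nbrs n u → u ∈ nbrs n v
    symmetric v∈ with u<n , v∈₀ ← ∈-nbrs⁻ v∈ = ∈-nbrs⁺ (nbrs₀-bounded u<n v∈₀) (nbrs₀-sym u<n v∈₀)
    irrefl : ∀ v → v ∉ nbrs n v
    irrefl v v∈ with v<n , v∈₀ ← ∈-nbrs⁻ v∈ | <-or-+ 7 v
    ... | inj₁ v<7       = All.lookup gadget-irrefl (∈-upTo⁺ v<7) v∈₀
    ... | inj₂ (k , refl) = tail-irrefl k v<n v∈₀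
    unique : ∀ v → Unique (nbrs n v)
    unique v with v <? n
    ... | no  v≮n rewrite nbrs≡[] v≮n = []
    ... | yes v<n rewrite nbrs≡nbrs₀ v<n with <-or-+ 7 v
    ...   | inj₁ v<7       = All.lookup gadget-unique (∈-upTo⁺ v<7)
    ...   | inj₂ (k , refl) = tail-unique k v<n

  open FromAdjacencyList adjacencyList using (graph; Automorphism; ∈⇒Adj; nbrs-<)
  open Refinement adjacencyList
  open Profiles (nbrs n)
  open Checks (checks 14≤n)

  degree-4 : ∀ {v} → v < n → length (nbrs n v) ≡ 4
  degree-4 {v} v<n = trans (cong length (nbrs≡nbrs₀ v<n)) (nbrs₀-length v)

  descend : ∀ {v} → 0 < v → v < n → ∃[ u ] u < v × u ∈ nbrs n v
  descend {v} 0<v v<n with <-or-+ 7 v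
  ... | inj₂ (k , refl) = 5 + k , s≤s (n≤1+n (5 + k)) , ∈-nbrs⁺ v<n (there (here refl))
  ... | inj₁ v<7 with All.lookup gadget-descends (∈-upTo⁺ v<7)
  ...   | inj₁ refl = ⊥-elim (<-irrefl refl 0<v)
  ...   | inj₂ below with u , u∈ , u<v ← find below = u , u<v , ∈-nbrs⁺ v<n u∈

  no-triangle : ∀ {u v w} → v ∈ nbrs n u → w ∈ nbrs n u → w ∉ nbrs n v
  no-triangle {u} {v} {w} v∈ w∈ w∈v with <-or-+ 13 u
  ... | inj₁ u<13 = All.lookup (All.lookup (All.lookup triangle-free-near-gadget (∈-upTo⁺ u<13)) v∈) w∈ w∈v
  ... | inj₂ (k , refl)
    with u<n , v∈₀ ← ∈-nbrs⁻ v∈ | _ , w∈₀ ← ∈-nbrs⁻ w∈ | v<n , w∈v₀ ← ∈-nbrs⁻ w∈v | <-or-+ 7 v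
  ... | inj₁ v<7        = ⊥-elim (<⇒≱ v<7 (tail-nbrs-≥7 k u<n v∈₀))
  ... | inj₂ (j , refl) =
    no-mod4-triangle {n} {13 + k} {7 + j} {w}
      (tail-mod4 (6 + k) u<n v∈₀) (tail-mod4 (6 + k) u<n w∈₀) (tail-mod4 j v<n w∈v₀)

  vertex : ∀ k → {True (k <? 14)} → Fin n
  vertex k {k<14} = fromℕ< (<-≤-trans (toWitness k<14) 14≤n)

  odd-cycle : Walk graph (vertex 0) (vertex 0)
  odd-cycle = step (edge 0 1 (here refl)) (step (edge 1 2 (there (here refl)))
    (step (edge 2 8 (there (there (there (here refl))))) (step (edge 8 6 (there (here refl)))
    (step (edge 6 0 (here refl)) here))))
    where
    edge : ∀ u v {u<14 : True (u <? 14)} {v<14 : True (v <? 14)} →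
           v ∈ nbrs₀ n u → Adj graph (vertex u {u<14}) (vertex v {v<14})
    edge u v {u<14} {v<14} v∈ = ∈⇒Adj u<n (<-≤-trans (toWitness v<14) 14≤n) (∈-nbrs⁺ u<n v∈)
      where u<n = <-≤-trans (toWitness u<14) 14≤n

  partner-four-below : ∀ j → 11 + j < n → 7 + j ∈ partners 3 (11 + j)
  partner-four-below j x<n =
    ∈-filter⁺ (λ y → ¬? (y ≟ 11 + j) ×-dec 3 ≤? #common (11 + j) y) in-nbrs²
      (≢-+ʳ (λ ()) j , three-common)
    where
    v<n : 7 + j < n
    v<n = ≤-<-trans (m≤n+m (7 + j) 4) x<n
    m<n : 9 + j < n
    m<n = ≤-<-trans (m≤n+m (9 + j) 2) x<n
    in-nbrs² : 7 + j ∈ nbrs² (11 + j)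
    in-nbrs² = ∈-deduplicate⁺ _≟_ (∈-concatMap⁺ (nbrs n)
      (lose (∈-nbrs⁺ x<n (there (here refl))) (∈-nbrs⁺ m<n (there (here refl)))))
    three-common : 3 ≤ #common (11 + j) (7 + j)
    three-common = subst (λ xs → 3 ≤ length (filter (_∈? nbrs n (7 + j)) xs)) (sym (nbrs≡nbrs₀ x<n))
      (length-≤-filter-++ (_∈? nbrs n (7 + j)) {zs = fold n (17 + j) ∷ []}
        (∈-nbrs⁺ v<n (there (here refl)) ∷ ∈-nbrs⁺ v<n (there (there (here (sym (fold-inside m<n)))))
          ∷ ∈-nbrs⁺ v<n (there (there (there (here refl)))) ∷ []))

  partnered : ∀ {x} → x < n → x ≢ 6 → 0 < length (partners 3 x)
  partnered {x} x<n x≢6 with <-or-+ 11 x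
  ... | inj₁ x<11 with All.lookup partnered-below-11 (∈-upTo⁺ x<11)
  ...   | inj₁ x≡6      = ⊥-elim (x≢6 x≡6)
  ...   | inj₂ 0<length = 0<length
  partnered x<n x≢6 | inj₂ (j , refl) = ∈-length (partner-four-below j x<n)

  fixes-6 : ∀ (A : Automorphism) → Automorphism.to A 6 ≡ 6
  fixes-6 A = fixes-only-partnerless A 3 (∈-nbrs⁺ (<-≤-trans (from-yes (6 <? 14)) 14≤n) (here refl))
    six-partnerless partnered

  fixes-below-13 : ∀ (A : Automorphism) {x} → x < 13 → Automorphism.to A x ≡ x
  fixes-below-13 A x<13 with All.lookup certificate-covers (∈-upTo⁺ x<13)
  ... | here refl = fixes-6 A
  ... | there x∈  = fixes-certified A (λ { (here refl) → fixes-6 A ; (there ()) }) certified x∈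

  fixes-all : ∀ (A : Automorphism) {x} → x < n → Automorphism.to A x ≡ x
  fixes-all A {x} = <-rec (λ x → x < n → to x ≡ x) go x
    where
    open Automorphism A
    go : ∀ x → (∀ {y} → y < x → y < n → to y ≡ y) → x < n → to x ≡ x
    go x rec x<n with <-or-+ 13 x
    ... | inj₁ x<13       = fixes-below-13 A x<13
    ... | inj₂ (j , refl) =
      fixes-last-neighbour A (∈-nbrs⁺ v<n (there (there (there (here (sym (fold-inside x<n)))))))
        (rec (m≤n+m (8 + j) 5) v<n) (λ z∈ z≢x → rec (below z∈ z≢x) (nbrs-< z∈))
      where
      v<n : 7 + j < n
      v<n = ≤-<-trans (m≤n+m (7 + j) 6) x<n
      below : ∀ {z} → z ∈ nbrs n (7 + j) → z ≢ 13 + j → z < 13 + j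
      below z∈ z≢x with ∈-nbrs⁻ z∈
      ... | _ , here refl                         = s≤s (m≤n+m (1 + j) 11)
      ... | _ , there (here refl)                 = s≤s (m≤n+m (5 + j) 7)
      ... | _ , there (there (here refl))
            rewrite fold-inside (≤-<-trans (m≤n+m (9 + j) 4) x<n) = s≤s (m≤n+m (9 + j) 3)
      ... | _ , there (there (there (here refl))) = ⊥-elim (z≢x (fold-inside x<n))

-- The construction works for every n ≥ 14.
lemma3p4 : (n : ℕ) → 14 ≤ n → 2 ∣ n →
    Σ (Graph n) λ G →
      Connected G × Asymmetric G × Regular 4 G × ¬ Bipartite G × TriangleFree G
lemma3p4 n 14≤n _ =
  graph , connected descend , asymmetric fixes-all , regular degree-4 ,
  odd-closed-walk⇒¬bipartite odd-cycle refl , triangleFree no-triangle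
  where
  open Construction 14≤n
  open FromAdjacencyList adjacencyList
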